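{- For every $n\ge 2$, the meta-chain hexagonal cactus $M_n$ and the para-chain hexagonal cactus $L_n$ have the same Sombor index: $SO(M_n)=SO(L_n)$, where $SO(G)=\sum_{uv\in E(G)}\sqrt{d_u^2+d_v^2}$ and $d_w$ is the degree of $w$.
   Context: A $6$-cycle chain of length $n\ge2$ is a graph formed by hexagons $Z_1,\dots,Z_n$ such that for $i=1,\dots,n-1$, $Z_i$ and $Z_{i+1}$ share exactly one vertex $c_i$ (the $c_i$ distinct), with no other shared vertices or edges. $L_n$ is such a chain in which, for each $2\le i\le n-1$, the cut vertices $c_{i-1},c_i$ are at distance $3$ in $Z_i$; $M_n$ is such a chain in which they are at distance $2$ in $Z_i$. -}

module Defs where

open import Level using (Level)
open import Data.Nat using (ℕ; zero; suc; _+_; _*_; _∸_; _≡ᵇ_; _⊔_; _⊓_; _≤_)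
open import Data.Bool using (Bool; _∨_)
open import Data.List using (List; []; _∷_; _++_; length; filter; foldr)
open import Data.List.Relation.Unary.All using (All)
open import Data.Product using (_×_; _,_)
open import Relation.Binary.PropositionalEquality using (_≡_)
open import Relation.Nullary.Decidable using (does)
open import Data.Bool.Properties using (T?)
open import Data.Bool using (T)
open import Algebra.Bundles using (CommutativeRing)

Edge : Set
Edge = ℕ × ℕ

incident : ℕ → Edge → Bool
incident v (a , b) = (a ≡ᵇ v) ∨ (b ≡ᵇ v)

deg : List Edge → ℕ → ℕ
deg E v = length (filter (λ e → T? (incident v e)) E)

-- A hexagon Z_i has local vertex positions 0..5 in cyclic order;
-- local position 0 is the entry cut vertex c_{i-1} (for i ≥ 2), and the
-- exit cut vertex c_i is at local position k_i ∈ {1,…,5}.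

hexDist : ℕ → ℕ
hexDist k = k ⊓ (6 ∸ k)

loc : ℕ → ℕ → ℕ → ℕ
loc e f zero    = e
loc e f (suc j) = f + j

hexEdges : (ℕ → ℕ) → List Edge
hexEdges g = (g 0 , g 1) ∷ (g 1 , g 2) ∷ (g 2 , g 3) ∷ (g 3 , g 4)
           ∷ (g 4 , g 5) ∷ (g 5 , g 0) ∷ []

-- build f e ks : the chain of (length ks + 1) hexagons, the first of which
-- has entry label e and fresh labels f … f+4, and ks lists the exit
-- positions of all hexagons but the last.
build : ℕ → ℕ → List ℕ → List Edge
build f e []       = hexEdges (loc e f)
build f e (k ∷ ks) = hexEdges (loc e f) ++ build (f + 5) (loc e f k) ks

chain : List ℕ → List Edge
chain ks = build 1 0 ks

ValidExit : ℕ → Set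
ValidExit k = (1 ≤ k) × (k ≤ 5)

-- L_n : every inner hexagon Z_i (2 ≤ i ≤ n-1) has c_{i-1}, c_i at distance 3
IsParaChain : List ℕ → Set
IsParaChain []       = Data.Empty.⊥ where import Data.Empty
IsParaChain (k ∷ ks) = ValidExit k × All (λ k′ → ValidExit k′ × (hexDist k′ ≡ 3)) ks

IsMetaChain : List ℕ → Set
IsMetaChain []       = Data.Empty.⊥ where import Data.Empty
IsMetaChain (k ∷ ks) = ValidExit k × All (λ k′ → ValidExit k′ × (hexDist k′ ≡ 2)) ks

module _ {c ℓ : Level} (R : CommutativeRing c ℓ) where
  open CommutativeRing R using (Carrier; _≈_; 0#; 1#) renaming (_+_ to _+ᴿ_; _*_ to _*ᴿ_)

  fromℕ : ℕ → Carrier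
  fromℕ zero    = 0#
  fromℕ (suc n) = 1# +ᴿ fromℕ n

  IsSqrt : (ℕ → Carrier) → Set ℓ
  IsSqrt √ = ∀ k → √ k *ᴿ √ k ≈ fromℕ k

  sombor : (ℕ → Carrier) → List Edge → Carrier
  sombor √ E = foldr (λ { (a , b) acc → √ (deg E a * deg E a + deg E b * deg E b) +ᴿ acc }) 0# E

-- The Sombor index is a sum of √(d_u² + d_v²) over the edges, so it only depends on the multiset of
-- edge weights d_u² + d_v². In a 6-cycle chain all vertices have degree 2 except the cut vertices,
-- which have degree 4. Wherever its cut vertex lies, the first hexagon has two edges of weight 20 and
-- four of weight 8; an inner hexagon of M_n or L_n has two non-adjacent cut vertices, hence four edges
-- of weight 20 and two of weight 8; the last hexagons agree. So the edge-weight lists of M_n and L_n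
-- are permutations of each other, and no property of √ is needed.

module Submission where

open import Defs
open import Level using (Level)
open import Data.Bool using (true; false; if_then_else_; T)
open import Data.Empty using (⊥-elim)
open import Data.Fin using (Fin; toℕ)
open import Data.Fin.Patterns using (0F; 1F; 2F; 3F; 4F; 5F)
open import Data.Fin.Properties using (toℕ≤pred[n])
open import Data.List using (List; []; _∷_; _++_; map; foldr; replicate; length)
open import Data.List.Properties using (map-++; ++-assoc; foldr-map; foldr-cong; map-∘)
open import Data.List.Relation.Unary.All as All using (All; []; _∷_)
open import Data.List.Relation.Unary.All.Properties using (++⁺)
open import Data.List.Relation.Binary.Permutation.Propositional using (_↭_; prep; ↭-refl; ↭-sym; ↭-reflexive; ↭⇒↭ₛ′; module PermutationReasoning)
open import Data.List.Relation.Binary.Permutation.Propositional.Properties as ↭ using (map⁺; shift; ++-comm)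
import Data.List.Relation.Binary.Permutation.Setoid.Properties as ↭ₛ
open import Data.Nat using (ℕ; zero; suc; _+_; _*_; _∸_; _≤_; _<_; _≡ᵇ_; z≤n; s≤s)
open import Data.Nat.Properties using (_≟_; ≡ᵇ⇒≡; ≤-trans; <-≤-trans; <⇒≢; >⇒≢; m≤m+n; +-monoʳ-<; +-cancelˡ-≡; suc-injective)
open import Data.Product as Prod using (_×_; _,_; proj₁; proj₂)
open import Data.Sum using (_⊎_; inj₁; inj₂)
open import Function using (_∘_; id)
open import Function.Definitions using (Injective)
open import Relation.Binary.PropositionalEquality using (_≡_; _≢_; refl; sym; trans; cong; cong₂; subst; module ≡-Reasoning)
open import Relation.Nullary using (yes; no)
open import Algebra.Bundles using (CommutativeRing)

Endpoints : (ℕ → Set) → Edge → Set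
Endpoints P (u , v) = P u × P v

≡ᵇ-refl : ∀ n → (n ≡ᵇ n) ≡ true
≡ᵇ-refl zero    = refl
≡ᵇ-refl (suc n) = ≡ᵇ-refl n

≢⇒≡ᵇ-false : ∀ {m n} → m ≢ n → (m ≡ᵇ n) ≡ false
≢⇒≡ᵇ-false {m} {n} m≢n with m ≡ᵇ n in eq
... | true  = ⊥-elim (m≢n (≡ᵇ⇒≡ m n (subst T (sym eq) _)))
... | false = refl

≡ᵇ-injective : ∀ {g : ℕ → ℕ} → Injective _≡_ _≡_ g → ∀ m n → (g m ≡ᵇ g n) ≡ (m ≡ᵇ n)
≡ᵇ-injective {g} inj m n with m ≟ n
... | yes refl = trans (≡ᵇ-refl (g m)) (sym (≡ᵇ-refl m))
... | no m≢n   = trans (≢⇒≡ᵇ-false (m≢n ∘ inj)) (sym (≢⇒≡ᵇ-false m≢n))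

deg-++ : ∀ A B v → deg (A ++ B) v ≡ deg A v + deg B v
deg-++ []            B v = refl
deg-++ ((a , b) ∷ A) B v with incident v (a , b)
... | true  = cong suc (deg-++ A B v)
... | false = deg-++ A B v

deg-absent : ∀ {E v} → All (Endpoints (_≢ v)) E → deg E v ≡ 0
deg-absent {[]}          []                  = refl
deg-absent {(a , b) ∷ E} {v} ((a≢v , b≢v) ∷ E≢v)
  rewrite ≢⇒≡ᵇ-false a≢v | ≢⇒≡ᵇ-false b≢v = deg-absent E≢v

deg-beyond : ∀ {E f v} → All (Endpoints (_< f)) E → f ≤ v → deg E v ≡ 0
deg-beyond E<f f≤v =
  deg-absent (All.map (λ (u<f , w<f) → <⇒≢ (<-≤-trans u<f f≤v) , <⇒≢ (<-≤-trans w<f f≤v)) E<f)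

deg-map-injective : ∀ {g} → Injective _≡_ _≡_ g → ∀ E v → deg (map (Prod.map g g) E) (g v) ≡ deg E v
deg-map-injective inj []            v = refl
deg-map-injective inj ((a , b) ∷ E) v
  rewrite ≡ᵇ-injective inj a v | ≡ᵇ-injective inj b v with incident v (a , b)
... | true  = cong suc (deg-map-injective inj E v)
... | false = deg-map-injective inj E v

hexEdges-endpoints : ∀ {P} g → ((j : Fin 6) → P (g (toℕ j))) → All (Endpoints P) (hexEdges g)
hexEdges-endpoints g p =
  (p 0F , p 1F) ∷ (p 1F , p 2F) ∷ (p 2F , p 3F) ∷ (p 3F , p 4F) ∷ (p 4F , p 5F) ∷ (p 5F , p 0F) ∷ []

deg-hexEdges : ∀ {g} → Injective _≡_ _≡_ g → ∀ {j} → j ≤ 5 → deg (hexEdges g) (g j) ≡ 2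
deg-hexEdges {g} inj {j} j≤5 = trans (deg-map-injective inj (hexEdges id) j) (deg-hexagon j≤5)
  where
  deg-hexagon : ∀ {j} → j ≤ 5 → deg (hexEdges id) j ≡ 2
  deg-hexagon {0} _ = refl
  deg-hexagon {1} _ = refl
  deg-hexagon {2} _ = refl
  deg-hexagon {3} _ = refl
  deg-hexagon {4} _ = refl
  deg-hexagon {5} _ = refl
  deg-hexagon {suc (suc (suc (suc (suc (suc _)))))} (s≤s (s≤s (s≤s (s≤s (s≤s ())))))

weight : (ℕ → ℕ) → Edge → ℕ
weight d (u , v) = d u * d u + d v * d v

hexWeights : (ℕ → ℕ) → List ℕ
hexWeights d = map (weight d) (hexEdges id)

hexWeights-relabel : ∀ D g d → ((j : Fin 6) → D (g (toℕ j)) ≡ d (toℕ j))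
                   → map (weight D) (hexEdges g) ≡ hexWeights d
hexWeights-relabel D g d p =
  cong₂ _∷_ (edge 0F 1F) (cong₂ _∷_ (edge 1F 2F) (cong₂ _∷_ (edge 2F 3F)
    (cong₂ _∷_ (edge 3F 4F) (cong₂ _∷_ (edge 4F 5F) (cong₂ _∷_ (edge 5F 0F) refl)))))
  where edge = λ i j → cong₂ (λ x y → x * x + y * y) (p i) (p j)

loc-injective : ∀ {e f} → e < f → Injective _≡_ _≡_ (loc e f)
loc-injective {e} {f} e<f {zero}  {zero}  _  = refl
loc-injective {e} {f} e<f {zero}  {suc j} eq = ⊥-elim (<⇒≢ (<-≤-trans e<f (m≤m+n f j)) eq)
loc-injective {e} {f} e<f {suc i} {zero}  eq = ⊥-elim (<⇒≢ (<-≤-trans e<f (m≤m+n f i)) (sym eq))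
loc-injective {e} {f} e<f {suc i} {suc j} eq = cong suc (+-cancelˡ-≡ f i j eq)

loc-entry-or-fresh : ∀ e f j → loc e f j ≡ e ⊎ f ≤ loc e f j
loc-entry-or-fresh e f zero    = inj₁ refl
loc-entry-or-fresh e f (suc j) = inj₂ (m≤m+n f j)

loc<f+5 : ∀ {e f j} → e < f → j ≤ 5 → loc e f j < f + 5
loc<f+5 {e} {f} {zero}  e<f _         = <-≤-trans e<f (m≤m+n f 5)
loc<f+5 {e} {f} {suc j} e<f (s≤s j≤4) = +-monoʳ-< f (s≤s j≤4)

build-endpoints : ∀ ks f e → All (Endpoints (λ x → x ≡ e ⊎ f ≤ x)) (build f e ks)
build-endpoints []       f e = hexEdges-endpoints (loc e f) (loc-entry-or-fresh e f ∘ toℕ)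
build-endpoints (k ∷ ks) f e =
  ++⁺ (hexEdges-endpoints (loc e f) (loc-entry-or-fresh e f ∘ toℕ))
      (All.map (Prod.map widen widen) (build-endpoints ks (f + 5) (loc e f k)))
  where
  widen : ∀ {x} → x ≡ loc e f k ⊎ f + 5 ≤ x → x ≡ e ⊎ f ≤ x
  widen (inj₁ refl)  = loc-entry-or-fresh e f k
  widen (inj₂ f+5≤x) = inj₂ (≤-trans (m≤m+n f 5) f+5≤x)

deg-build-absent : ∀ ks f e {v} → v ≢ e → v < f → deg (build f e ks) v ≡ 0
deg-build-absent ks f e v≢e v<f =
  deg-absent (All.map (Prod.map avoid avoid) (build-endpoints ks f e))
  where
  avoid : ∀ {x} → x ≡ e ⊎ f ≤ x → x ≢ _
  avoid (inj₁ refl) = v≢e ∘ sym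
  avoid (inj₂ f≤x)  = >⇒≢ (<-≤-trans v<f f≤x)

deg-build-entry : ∀ ks f e → e < f → All ValidExit ks → deg (build f e ks) e ≡ 2
deg-build-entry []           f e e<f _ = deg-hexEdges (loc-injective e<f) z≤n
deg-build-entry (suc k ∷ ks) f e e<f _ =
  trans (deg-++ (hexEdges (loc e f)) _ e)
        (cong₂ _+_ (deg-hexEdges (loc-injective e<f) z≤n)
                   (deg-build-absent ks (f + 5) (f + k) (<⇒≢ (<-≤-trans e<f (m≤m+n f k))) (loc<f+5 e<f z≤n)))
deg-build-entry (zero ∷ ks)  f e e<f ((() , _) ∷ _)

deg-build-below : ∀ ks f e {v} → e < f → All ValidExit ks → v < f
                → deg (build f e ks) v ≡ (if v ≡ᵇ e then 2 else 0)
deg-build-below ks f e {v} e<f valid v<f with v ≟ e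
... | yes refl = trans (deg-build-entry ks f e e<f valid) (cong (if_then 2 else 0) (sym (≡ᵇ-refl v)))
... | no v≢e   = trans (deg-build-absent ks f e v≢e v<f) (cong (if_then 2 else 0) (sym (≢⇒≡ᵇ-false v≢e)))

deg-prefix-loc : ∀ {P f} e j → All (Endpoints (_< f)) P
               → deg P (loc e f j) ≡ (if j ≡ᵇ 0 then deg P e else 0)
deg-prefix-loc         e zero    P<f = refl
deg-prefix-loc {f = f} e (suc j) P<f = deg-beyond P<f (m≤m+n f j)

-- profile a x j is the degree of local position j of a hexagon whose entry vertex has a neighbours in
-- the hexagons before it and whose position j has x j neighbours in the hexagons after it.
exitAt : ℕ → ℕ → ℕ
exitAt k j = if j ≡ᵇ k then 2 else 0

profile : ℕ → (ℕ → ℕ) → ℕ → ℕ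
profile a x j = (if j ≡ᵇ 0 then a else 0) + (2 + x j)

chainWeights : ℕ → List ℕ → List ℕ
chainWeights a []       = hexWeights (profile a (λ _ → 0))
chainWeights a (k ∷ ks) = hexWeights (profile a (exitAt k)) ++ chainWeights 2 ks

-- P stands for the hexagons built before: its vertices all lie below the fresh labels f, f + 1, ….
build-weights : ∀ {P} ks f e → e < f → All (Endpoints (_< f)) P → All ValidExit ks
              → map (weight (deg (P ++ build f e ks))) (build f e ks) ≡ chainWeights (deg P e) ks
build-weights {P} [] f e e<f P<f [] =
  hexWeights-relabel (deg (P ++ hexEdges (loc e f))) (loc e f) (profile (deg P e) (λ _ → 0))
                     (λ j → position (toℕ≤pred[n] j))
  where
  position : ∀ {j} → j ≤ 5 → deg (P ++ hexEdges (loc e f)) (loc e f j) ≡ profile (deg P e) (λ _ → 0) j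
  position {j} j≤5 =
    trans (deg-++ P _ _) (cong₂ _+_ (deg-prefix-loc e j P<f) (deg-hexEdges (loc-injective e<f) j≤5))
build-weights {P} (zero  ∷ ks) f e e<f P<f ((() , _) ∷ _)
build-weights {P} (suc k ∷ ks) f e e<f P<f ((_ , k<5) ∷ valid) = begin
  map (weight (deg (P ++ H ++ B))) (H ++ B)
    ≡⟨ map-++ _ H B ⟩
  map (weight (deg (P ++ H ++ B))) H ++ map (weight (deg (P ++ H ++ B))) B
    ≡⟨ cong₂ _++_ hexagon rest ⟩
  chainWeights (deg P e) (suc k ∷ ks) ∎
  where
  open ≡-Reasoning
  H = hexEdges (loc e f)
  B = build (f + 5) (f + k) ks
  f+k<f+5 : f + k < f + 5
  f+k<f+5 = loc<f+5 e<f k<5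
  position : ∀ {j} → j ≤ 5 → deg (P ++ H ++ B) (loc e f j) ≡ profile (deg P e) (exitAt (suc k)) j
  position {j} j≤5 = begin
    deg (P ++ H ++ B) (loc e f j)
      ≡⟨ trans (deg-++ P _ _) (cong (deg P _ +_) (deg-++ H B _)) ⟩
    deg P (loc e f j) + (deg H (loc e f j) + deg B (loc e f j))
      ≡⟨ cong₂ _+_ (deg-prefix-loc e j P<f) (cong₂ _+_ (deg-hexEdges (loc-injective e<f) j≤5)
                    (deg-build-below ks (f + 5) (f + k) f+k<f+5 valid (loc<f+5 e<f j≤5))) ⟩
    (if j ≡ᵇ 0 then deg P e else 0) + (2 + (if loc e f j ≡ᵇ loc e f (suc k) then 2 else 0))
      ≡⟨ cong (λ b → (if j ≡ᵇ 0 then deg P e else 0) + (2 + (if b then 2 else 0)))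
              (≡ᵇ-injective (loc-injective e<f) j (suc k)) ⟩
    profile (deg P e) (exitAt (suc k)) j ∎
  hexagon : map (weight (deg (P ++ H ++ B))) H ≡ hexWeights (profile (deg P e) (exitAt (suc k)))
  hexagon = hexWeights-relabel (deg (P ++ H ++ B)) (loc e f) (profile (deg P e) (exitAt (suc k)))
                               (λ j → position (toℕ≤pred[n] j))
  P++H<f+5 : All (Endpoints (_< f + 5)) (P ++ H)
  P++H<f+5 = ++⁺ (All.map (Prod.map widen widen) P<f)
                 (hexEdges-endpoints (loc e f) (λ j → loc<f+5 e<f (toℕ≤pred[n] j)))
    where widen = λ {x} (x<f : x < f) → <-≤-trans x<f (m≤m+n f 5)
  deg-next-entry : deg (P ++ H) (f + k) ≡ 2
  deg-next-entry =
    trans (deg-++ P H _) (cong₂ _+_ (deg-beyond P<f (m≤m+n f k)) (deg-hexEdges (loc-injective e<f) k<5))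
  rest : map (weight (deg (P ++ H ++ B))) B ≡ chainWeights 2 ks
  rest = begin
    map (weight (deg (P ++ H ++ B))) B    ≡⟨ cong (λ G → map (weight (deg G)) B) (sym (++-assoc P H B)) ⟩
    map (weight (deg ((P ++ H) ++ B))) B  ≡⟨ build-weights ks (f + 5) (f + k) f+k<f+5 P++H<f+5 valid ⟩
    chainWeights (deg (P ++ H) (f + k)) ks ≡⟨ cong (λ a → chainWeights a ks) deg-next-entry ⟩
    chainWeights 2 ks ∎

edgeWeights : List Edge → List ℕ
edgeWeights E = map (weight (deg E)) E

chain-weights : ∀ {ks} → All ValidExit ks → edgeWeights (chain ks) ≡ chainWeights 0 ks
chain-weights {ks} = build-weights {[]} ks 1 0 (s≤s z≤n) []

-- With exit k the list is 8 ∷ … (k ∸ 1 times) followed by 20 ∷ 20 ∷ 8 ∷ …: a rotation of the list for k = 1.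
first-hexagon-weights : ∀ {k} → ValidExit k
                      → hexWeights (profile 0 (exitAt k)) ↭ hexWeights (profile 0 (exitAt 1))
first-hexagon-weights {1} _ = ↭-refl
first-hexagon-weights {2} _ = ++-comm (replicate 1 8) _
first-hexagon-weights {3} _ = ++-comm (replicate 2 8) _
first-hexagon-weights {4} _ = ++-comm (replicate 3 8) _
first-hexagon-weights {5} _ = ++-comm (replicate 4 8) _
first-hexagon-weights {0} (() , _)
first-hexagon-weights {suc (suc (suc (suc (suc (suc _)))))} (_ , s≤s (s≤s (s≤s (s≤s (s≤s ())))))

innerWeights : ℕ → List ℕ
innerWeights k = hexWeights (profile 2 (exitAt k))

-- innerWeights 2 = 20 ∷ 20 ∷ 20 ∷ 8 ∷ 8 ∷ 20, innerWeights 3 = 20 ∷ 8 ∷ 20 ∷ 20 ∷ 8 ∷ 20 and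
-- innerWeights 4 = 20 ∷ 8 ∷ 8 ∷ 20 ∷ 20 ∷ 20.
meta-innerWeights : ∀ {k} → ValidExit k → hexDist k ≡ 2 → innerWeights k ↭ innerWeights 3
meta-innerWeights {2} _ _ = prep 20 (shift 8 (20 ∷ 20 ∷ []) (8 ∷ 20 ∷ []))
meta-innerWeights {4} _ _ = prep 20 (prep 8 (↭-sym (shift 8 (20 ∷ 20 ∷ []) (20 ∷ []))))
meta-innerWeights {0} (() , _) _
meta-innerWeights {1} _ ()
meta-innerWeights {3} _ ()
meta-innerWeights {5} _ ()
meta-innerWeights {suc (suc (suc (suc (suc (suc _)))))} (_ , s≤s (s≤s (s≤s (s≤s (s≤s ()))))) _

para-exit : ∀ {k} → ValidExit k → hexDist k ≡ 3 → k ≡ 3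
para-exit {3} _ _ = refl
para-exit {0} (() , _) _
para-exit {1} _ ()
para-exit {2} _ ()
para-exit {4} _ ()
para-exit {5} _ ()
para-exit {suc (suc (suc (suc (suc (suc _)))))} (_ , s≤s (s≤s (s≤s (s≤s (s≤s ()))))) _

inner-chainWeights : ∀ {ks} → All (λ k → innerWeights k ↭ innerWeights 3) ks
                   → chainWeights 2 ks ↭ chainWeights 2 (replicate (length ks) 3)
inner-chainWeights []       = ↭-refl
inner-chainWeights (p ∷ ps) = ↭.++⁺ p (inner-chainWeights ps)

chain-weights-↭ : ∀ {k ks} → ValidExit k
                → All (λ k′ → ValidExit k′ × (innerWeights k′ ↭ innerWeights 3)) ks
                → edgeWeights (chain (k ∷ ks)) ↭ chainWeights 0 (1 ∷ replicate (length ks) 3)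
chain-weights-↭ {k} {ks} valid inner = begin
  edgeWeights (chain (k ∷ ks))  ≡⟨ chain-weights (valid ∷ All.map proj₁ inner) ⟩
  chainWeights 0 (k ∷ ks)       ↭⟨ ↭.++⁺ (first-hexagon-weights valid) (inner-chainWeights (All.map proj₂ inner)) ⟩
  chainWeights 0 (1 ∷ replicate (length ks) 3) ∎
  where open PermutationReasoning

metaChain-weights : ∀ {k ks} → IsMetaChain (k ∷ ks)
                  → edgeWeights (chain (k ∷ ks)) ↭ chainWeights 0 (1 ∷ replicate (length ks) 3)
metaChain-weights (valid , inner) =
  chain-weights-↭ valid (All.map (λ (v , d) → v , meta-innerWeights v d) inner)

paraChain-weights : ∀ {k ks} → IsParaChain (k ∷ ks)
                  → edgeWeights (chain (k ∷ ks)) ↭ chainWeights 0 (1 ∷ replicate (length ks) 3)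
paraChain-weights (valid , inner) =
  chain-weights-↭ valid (All.map (λ (v , d) → v , ↭-reflexive (cong innerWeights (para-exit v d))) inner)

module _ {c ℓ : Level} (R : CommutativeRing c ℓ) (√ : ℕ → CommutativeRing.Carrier R) where
  open CommutativeRing R using (_≈_; 0#; setoid; isEquivalence; +-isCommutativeMonoid) renaming (_+_ to _⊕_)
  open import Relation.Binary.Reasoning.Setoid setoid

  sombor-as-sum : ∀ E → sombor R √ E ≡ foldr _⊕_ 0# (map √ (edgeWeights E))
  sombor-as-sum E = ≡.begin
    sombor R √ E                                     ≡.≡⟨ foldr-cong (λ { (a , b) _ → refl }) refl E ⟩
    foldr (λ e s → √ (weight (deg E) e) ⊕ s) 0# E   ≡.≡⟨ foldr-map _⊕_ (√ ∘ weight (deg E)) 0# E ⟨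
    foldr _⊕_ 0# (map (√ ∘ weight (deg E)) E)       ≡.≡⟨ cong (foldr _⊕_ 0#) (map-∘ E) ⟩
    foldr _⊕_ 0# (map √ (edgeWeights E))            ≡.∎
    where module ≡ = ≡-Reasoning

  sombor-↭ : ∀ {E E′} → edgeWeights E ↭ edgeWeights E′ → sombor R √ E ≈ sombor R √ E′
  sombor-↭ {E} {E′} E↭E′ = begin
    sombor R √ E                          ≡⟨ sombor-as-sum E ⟩
    foldr _⊕_ 0# (map √ (edgeWeights E))
      ≈⟨ ↭ₛ.foldr-commMonoid setoid +-isCommutativeMonoid (↭⇒↭ₛ′ isEquivalence (map⁺ √ E↭E′)) ⟩
    foldr _⊕_ 0# (map √ (edgeWeights E′)) ≡⟨ sombor-as-sum E′ ⟨
    sombor R √ E′                         ∎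

corollary2p5 : {c ℓ : Level} (R : CommutativeRing c ℓ) (√ : ℕ → CommutativeRing.Carrier R) → IsSqrt R √
    → (n : ℕ) → 2 ≤ n → (ms ps : List ℕ) → length ms ≡ n ∸ 1 → length ps ≡ n ∸ 1
    → IsMetaChain ms → IsParaChain ps
    → CommutativeRing._≈_ R (sombor R √ (chain ms)) (sombor R √ (chain ps))
corollary2p5 R √ _ _ _ (m ∷ ms) (p ∷ ps) |m∷ms| |p∷ps| meta para =
  sombor-↭ R √ {chain (m ∷ ms)} {chain (p ∷ ps)} (begin
  edgeWeights (chain (m ∷ ms))                   ↭⟨ metaChain-weights meta ⟩
  chainWeights 0 (1 ∷ replicate (length ms) 3)  ≡⟨ cong (λ l → chainWeights 0 (1 ∷ replicate l 3)) |ms|≡|ps| ⟩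
  chainWeights 0 (1 ∷ replicate (length ps) 3)  ↭⟨ paraChain-weights para ⟨
  edgeWeights (chain (p ∷ ps))                   ∎)
  where
  open PermutationReasoning
  |ms|≡|ps| : length ms ≡ length ps
  |ms|≡|ps| = suc-injective (trans |m∷ms| (sym |p∷ps|))
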